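{- Let $G$ be a Frobenius group whose Frobenius kernel $N$ is abelian, and let $H$ be a Frobenius complement. Then there is a set of $|H|$ mutually orthogonal group squares of order $n=|N|$ such that each of the $\binom{|H|+2}{3}$ Latin squares determined by it is isotopic to the Cayley table of $N$.
   Context: A Frobenius group is a finite group $G$ with a non-trivial proper subgroup $H$ (a Frobenius complement) such that $H\cap g^{ -1}Hg=1$ for all $g\in G\setminus H$; the identity together with the elements lying in no conjugate of $H$ form a normal subgroup $N$, the Frobenius kernel. A set of $r$ mutually orthogonal Latin squares of order $n$ on the $n\times n$ grid of cells $\Omega$ determines $r+2$ partitions of $\Omega$: into rows, into columns, and, for each square, into the sets of cells carrying the same letter; any three of these partitions determine a Latin square (using two of them as rows and columns and the third as letters), giving $\binom{r+2}{3}$ Latin squares. An isotopism between two Latin squares is a bijection between their cells mapping rows to rows, columns to columns and letters to letters. The set is a set of mutually orthogonal group squares if all these $\binom{r+2}{3}$ Latin squares are isotopic to Cayley tables of groups. -}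

module Defs where

open import Data.Nat using (ℕ; _+_)
open import Data.Fin using (Fin; zero; suc)
open import Data.Fin.Subset using (Subset; _∈_; _∉_; ∣_∣)
open import Data.Product using (Σ; ∃; ∃-syntax; _×_; _,_; proj₁; proj₂)
open import Data.Sum using (_⊎_)
open import Relation.Nullary using (¬_)
open import Relation.Binary.PropositionalEquality using (_≡_; _≢_)
open import Function.Definitions using (Injective; Bijective)
open import Algebra.Structures using (IsGroup)

-- Finite groups: a group structure (with propositional equality) on the
-- carrier Fin order.  Every finite group is isomorphic to one of these.

record FiniteGroup : Set where
  field
    order   : ℕ
    _∙_     : Fin order → Fin order → Fin order
    ε       : Fin order
    _⁻¹     : Fin order → Fin order
    isGroup : IsGroup _≡_ _∙_ ε _⁻¹
  infixl 7 _∙_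
  infix  8 _⁻¹

module _ (G : FiniteGroup) where
  open FiniteGroup G

  IsSubgroup : Subset order → Set
  IsSubgroup H = (ε ∈ H)
               × (∀ x y → x ∈ H → y ∈ H → x ∙ y ∈ H)
               × (∀ x → x ∈ H → x ⁻¹ ∈ H)

  IsFrobeniusComplement : Subset order → Set
  IsFrobeniusComplement H =
      IsSubgroup H
    × (∃[ h ] (h ∈ H × h ≢ ε))
    × (∃[ g ] (g ∉ H))
    × (∀ g → g ∉ H → ∀ x → x ∈ H → g ⁻¹ ∙ x ∙ g ∈ H → x ≡ ε)

  -- N is the Frobenius kernel w.r.t. H: the identity together with the
  -- elements lying in no conjugate g⁻¹Hg of H (x ∈ g⁻¹Hg ⇔ g x g⁻¹ ∈ H).
  IsFrobeniusKernel : Subset order → Subset order → Set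
  IsFrobeniusKernel H N =
    ∀ x → (x ∈ N → (x ≡ ε ⊎ (∀ g → g ∙ x ∙ g ⁻¹ ∉ H)))
        × ((x ≡ ε ⊎ (∀ g → g ∙ x ∙ g ⁻¹ ∉ H)) → x ∈ N)

  IsAbelianSubset : Subset order → Set
  IsAbelianSubset N = ∀ x y → x ∈ N → y ∈ N → x ∙ y ≡ y ∙ x

Cell : ℕ → Set
Cell n = Fin n × Fin n

LatinSquare : ℕ → Set
LatinSquare n = Fin n → Fin n → Fin n

IsLatin : ∀ {n} → LatinSquare n → Set
IsLatin {n} L = (∀ i → Bijective _≡_ _≡_ (L i))
              × (∀ j → Bijective _≡_ _≡_ (λ i → L i j))

Orthogonal : ∀ {n} → LatinSquare n → LatinSquare n → Set
Orthogonal {n} L M =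
  Bijective _≡_ _≡_ (λ (c : Cell n) → (L (proj₁ c) (proj₂ c) , M (proj₁ c) (proj₂ c)))

IsMOLS : ∀ {n r} → (Fin r → LatinSquare n) → Set
IsMOLS {n} {r} L = (∀ i → IsLatin (L i))
                 × (∀ i j → i ≢ j → Orthogonal (L i) (L j))

-- A partition is given by its class-labelling map Ω → Fin n
-- (two cells are in the same part iff they get the same label).
partitionOf : ∀ {n r} → (Fin r → LatinSquare n) → Fin (2 + r) → Cell n → Fin n
partitionOf L zero             (i , j) = i
partitionOf L (suc zero)       (i , j) = j
partitionOf L (suc (suc k))    (i , j) = L k i j

-- The Latin square on the cells Ω with rows given by partition a, columns
-- by partition b and letters by partition c is isotopic to the Cayley table
-- of the subgroup N of G: there is a bijection φ from Ω onto the cells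
-- N × N of the Cayley table of N mapping rows to rows, columns to columns
-- and letters to letters (the Cayley table of N has cell (x , y) in row x,
-- column y, with letter x ∙ y).
IsotopicToCayley : ∀ {n} (G : FiniteGroup) (N : Subset (FiniteGroup.order G))
                   (P : Cell n → Fin n) (Q : Cell n → Fin n) (R : Cell n → Fin n) → Set
IsotopicToCayley {n} G N P Q R =
  Σ (Cell n → Fin order × Fin order) λ φ →
      Injective _≡_ _≡_ φ
    × (∀ ω → proj₁ (φ ω) ∈ N × proj₂ (φ ω) ∈ N)
    × (∀ x y → x ∈ N → y ∈ N → ∃[ ω ] (φ ω ≡ (x , y)))
    × (∀ ω ω′ → (P ω ≡ P ω′ → proj₁ (φ ω) ≡ proj₁ (φ ω′))
              × (proj₁ (φ ω) ≡ proj₁ (φ ω′) → P ω ≡ P ω′))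
    × (∀ ω ω′ → (Q ω ≡ Q ω′ → proj₂ (φ ω) ≡ proj₂ (φ ω′))
              × (proj₂ (φ ω) ≡ proj₂ (φ ω′) → Q ω ≡ Q ω′))
    × (∀ ω ω′ → (R ω ≡ R ω′ → proj₁ (φ ω) ∙ proj₂ (φ ω) ≡ proj₁ (φ ω′) ∙ proj₂ (φ ω′))
              × (proj₁ (φ ω) ∙ proj₂ (φ ω) ≡ proj₁ (φ ω′) ∙ proj₂ (φ ω′) → R ω ≡ R ω′))
  where open FiniteGroup G

-- Write N additively.  Conjugation by the elements h of H gives |H| automorphisms σ_h of N,
-- and H acts fixed-point-freely on N, so σ_h − σ_h′ is injective for h ≠ h′; adding the
-- zero map gives |H| + 1 endomorphisms τ_s with pairwise injective (hence bijective)
-- differences.  On the grid N × N the classes of "lines" i + τ_s j = const (the rows for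
-- τ = 0, the letters i + σ_h j of the square for h), together with the columns, are then
-- pairwise orthogonal.  Any three of these partitions are linearly related: for distinct
-- s, t, u, the value i + τ_u j is α(i + τ_s j) + β(i + τ_t j) for injective maps α, β built
-- from (τ_s − τ_t)⁻¹, so each triple is isotopic to the Cayley table of N.  That N is a
-- subgroup at all comes from its commutativity: a nontrivial product of two kernel elements
-- lying in H would commute with one of them.

module Submission where

open import Defs
open import Level using (0ℓ)
open import Data.Nat using (ℕ; suc; _+_)
open import Data.Nat.Properties using (1+n≰n)
open import Data.Bool using (true; false)
open import Data.Fin using (Fin; zero; suc; _≟_; punchOut)
open import Data.Fin.Properties using (suc-injective; punchOut-injective; injective⇒≤; any?)
open import Data.Fin.Subset using (Subset; _∈_; _∉_; ∣_∣)
open import Data.Vec.Base using (_∷_; here; there)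
open import Data.Product using (Σ; ∃-syntax; _×_; _,_; proj₁; proj₂)
open import Data.Sum using (_⊎_; inj₁; inj₂)
open import Function.Base using (_∘_)
open import Function.Definitions using (Injective; Bijective; StrictlySurjective)
open import Function.Consequences.Propositional using (strictlySurjective⇒surjective)
open import Relation.Nullary using (yes; no)
open import Relation.Nullary.Negation using (contradiction)
open import Relation.Binary.PropositionalEquality
open import Algebra.Definitions using (Commutative)
open import Algebra.Bundles using (Group; AbelianGroup)
open import Algebra.Structures using (IsGroup)
open import Algebra.Morphism.Structures using (IsGroupMonomorphism)
import Algebra.Morphism.GroupMonomorphism as GroupMonomorphism

injective⇒strictlySurjective : ∀ {n} {f : Fin n → Fin n} →
                               Injective _≡_ _≡_ f → StrictlySurjective _≡_ f
injective⇒strictlySurjective {suc m} {f} f-injective y with any? (λ x → f x ≟ y)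
... | yes hit  = hit
... | no ¬hit = contradiction (injective⇒≤ g-injective) 1+n≰n
  where
  y≢f : ∀ x → y ≢ f x
  y≢f x y≡fx = ¬hit (x , sym y≡fx)

  g : Fin (suc m) → Fin m
  g x = punchOut (y≢f x)
  g-injective : Injective _≡_ _≡_ g
  g-injective {x} {x′} eq = f-injective (punchOut-injective (y≢f x) (y≢f x′) eq)

enum : ∀ {m} (p : Subset m) → Fin ∣ p ∣ → Fin m
enum (true  ∷ p) zero    = zero
enum (true  ∷ p) (suc i) = suc (enum p i)
enum (false ∷ p) i       = suc (enum p i)

enum-∈ : ∀ {m} (p : Subset m) i → enum p i ∈ p
enum-∈ (true  ∷ p) zero    = here
enum-∈ (true  ∷ p) (suc i) = there (enum-∈ p i)
enum-∈ (false ∷ p) i       = there (enum-∈ p i)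

enum-injective : ∀ {m} (p : Subset m) → Injective _≡_ _≡_ (enum p)
enum-injective (true  ∷ p) {zero}  {zero}  _  = refl
enum-injective (true  ∷ p) {suc i} {suc j} eq = cong suc (enum-injective p (suc-injective eq))
enum-injective (false ∷ p)                 eq = enum-injective p (suc-injective eq)

index : ∀ {m} (p : Subset m) {x} → x ∈ p → Fin ∣ p ∣
index (true  ∷ p) here      = zero
index (true  ∷ p) (there x∈p) = suc (index p x∈p)
index (false ∷ p) (there x∈p) = index p x∈p

enum-index : ∀ {m} (p : Subset m) {x} (x∈p : x ∈ p) → enum p (index p x∈p) ≡ x
enum-index (true  ∷ p) here        = refl
enum-index (true  ∷ p) (there x∈p) = cong suc (enum-index p x∈p)
enum-index (false ∷ p) (there x∈p) = cong suc (enum-index p x∈p)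

module _ {m} (p : Subset m) {f : Fin m → Fin m} (f-∈ : ∀ {x} → x ∈ p → f x ∈ p) where

  restrict : Fin ∣ p ∣ → Fin ∣ p ∣
  restrict i = index p (f-∈ (enum-∈ p i))

  enum-restrict : ∀ i → enum p (restrict i) ≡ f (enum p i)
  enum-restrict i = enum-index p _

  restrict-injective : Injective _≡_ _≡_ f → Injective _≡_ _≡_ restrict
  restrict-injective f-injective {i} {j} eq = enum-injective p (f-injective (begin
    f (enum p i)         ≡⟨ enum-restrict i ⟨
    enum p (restrict i)  ≡⟨ cong (enum p) eq ⟩
    enum p (restrict j)  ≡⟨ enum-restrict j ⟩
    f (enum p j)         ∎))
    where open ≡-Reasoning

IsEndomorphism : (G : FiniteGroup) → (Fin (FiniteGroup.order G) → Fin (FiniteGroup.order G)) → Set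
IsEndomorphism G F = ∀ x y → F (x ∙ y) ≡ F x ∙ F y
  where open FiniteGroup G

module GroupProperties (G : FiniteGroup) where

  open FiniteGroup G
  open IsGroup isGroup using (assoc; identityˡ; identityʳ; inverseˡ; inverseʳ; _//_)

  group : Group 0ℓ 0ℓ
  group = record { isGroup = isGroup }

  open import Algebra.Properties.Group group
  open ≡-Reasoning

  module _ {F : Fin order → Fin order} (F-homo : IsEndomorphism G F) where

    homo⇒ε-homo : F ε ≡ ε
    homo⇒ε-homo = identityʳ-unique (F ε) (F ε) (begin
      F ε ∙ F ε  ≡⟨ F-homo ε ε ⟨
      F (ε ∙ ε)  ≡⟨ cong F (identityˡ ε) ⟩
      F ε        ∎)

    homo⇒⁻¹-homo : ∀ x → F (x ⁻¹) ≡ F x ⁻¹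
    homo⇒⁻¹-homo x = inverseˡ-unique (F (x ⁻¹)) (F x) (begin
      F (x ⁻¹) ∙ F x  ≡⟨ F-homo (x ⁻¹) x ⟨
      F (x ⁻¹ ∙ x)    ≡⟨ cong F (inverseˡ x) ⟩
      F ε             ≡⟨ homo⇒ε-homo ⟩
      ε               ∎)

    homo⇒//-homo : ∀ x y → F (x // y) ≡ F x // F y
    homo⇒//-homo x y = trans (F-homo x (y ⁻¹)) (cong (F x ∙_) (homo⇒⁻¹-homo y))

    trivialKernel⇒injective : (∀ x → F x ≡ ε → x ≡ ε) → Injective _≡_ _≡_ F
    trivialKernel⇒injective trivial {x} {y} Fx≡Fy = x∙y⁻¹≈ε⇒x≈y x y (trivial (x // y) (begin
      F (x // y)   ≡⟨ homo⇒//-homo x y ⟩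
      F x // F y   ≡⟨ cong (_// F y) Fx≡Fy ⟩
      F y // F y   ≡⟨ inverseʳ (F y) ⟩
      ε            ∎))

  conj : Fin order → Fin order → Fin order
  conj g x = g ∙ x ∙ g ⁻¹

  conj-∙ : ∀ g x → conj g x ∙ g ≡ g ∙ x
  conj-∙ g x = //-rightDividesˡ g (g ∙ x)

  conj-unique : ∀ {g x z} → z ∙ g ≡ g ∙ x → z ≡ conj g x
  conj-unique {g} {x} {z} zg≡gx = trans (sym (//-rightDividesʳ g z)) (cong (_// g) zg≡gx)

  conj-homo : ∀ g → IsEndomorphism G (conj g)
  conj-homo g x y = sym (conj-unique (begin
    conj g x ∙ conj g y ∙ g    ≡⟨ assoc (conj g x) (conj g y) g ⟩
    conj g x ∙ (conj g y ∙ g)  ≡⟨ cong (conj g x ∙_) (conj-∙ g y) ⟩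
    conj g x ∙ (g ∙ y)         ≡⟨ assoc (conj g x) g y ⟨
    conj g x ∙ g ∙ y           ≡⟨ cong (_∙ y) (conj-∙ g x) ⟩
    g ∙ x ∙ y                  ≡⟨ assoc g x y ⟩
    g ∙ (x ∙ y)                ∎))

  conj-∘ : ∀ g h x → conj g (conj h x) ≡ conj (g ∙ h) x
  conj-∘ g h x = conj-unique (begin
    conj g (conj h x) ∙ (g ∙ h)  ≡⟨ assoc (conj g (conj h x)) g h ⟨
    conj g (conj h x) ∙ g ∙ h    ≡⟨ cong (_∙ h) (conj-∙ g (conj h x)) ⟩
    g ∙ conj h x ∙ h             ≡⟨ assoc g (conj h x) h ⟩
    g ∙ (conj h x ∙ h)           ≡⟨ cong (g ∙_) (conj-∙ h x) ⟩
    g ∙ (h ∙ x)                  ≡⟨ assoc g h x ⟨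
    g ∙ h ∙ x                    ∎)

  conj-identity : ∀ x → conj ε x ≡ x
  conj-identity x = sym (conj-unique (trans (identityʳ x) (sym (identityˡ x))))

  conj-ε : ∀ g → conj g ε ≡ ε
  conj-ε g = homo⇒ε-homo (conj-homo g)

  conj-injective : ∀ g → Injective _≡_ _≡_ (conj g)
  conj-injective g {x} {y} eq = ∙-cancelˡ g x y (begin
    g ∙ x         ≡⟨ conj-∙ g x ⟨
    conj g x ∙ g  ≡⟨ cong (_∙ g) eq ⟩
    conj g y ∙ g  ≡⟨ conj-∙ g y ⟩
    g ∙ y         ∎)

  conj-trivialKernel : ∀ g {x} → conj g x ≡ ε → x ≡ ε
  conj-trivialKernel g {x} gxg⁻¹≡ε = conj-injective g (trans gxg⁻¹≡ε (sym (conj-ε g)))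

record OrthogonalPartitions {n} (P Q : Cell n → Fin n) : Set where
  field
    injective  : ∀ {ω ω′} → P ω ≡ P ω′ → Q ω ≡ Q ω′ → ω ≡ ω′
    surjective : ∀ p q → ∃[ ω ] P ω ≡ p × Q ω ≡ q

module _ {n} {P Q : Cell n → Fin n} where

  OrthogonalPartitions-sym : OrthogonalPartitions P Q → OrthogonalPartitions Q P
  OrthogonalPartitions-sym orth = record
    { injective  = λ Qω≡Qω′ Pω≡Pω′ → injective Pω≡Pω′ Qω≡Qω′
    ; surjective = λ q p → let ω , Pω≡p , Qω≡q = surjective p q in ω , Qω≡q , Pω≡p
    }
    where open OrthogonalPartitions orth

  OrthogonalPartitions-resp-≗ : ∀ {P′ Q′} → P ≗ P′ → Q ≗ Q′ →
                                OrthogonalPartitions P Q → OrthogonalPartitions P′ Q′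
  OrthogonalPartitions-resp-≗ P≗P′ Q≗Q′ orth = record
    { injective  = λ {ω} {ω′} e₁ e₂ → injective (trans (P≗P′ ω) (trans e₁ (sym (P≗P′ ω′))))
                                                (trans (Q≗Q′ ω) (trans e₂ (sym (Q≗Q′ ω′))))
    ; surjective = λ p q → let ω , Pω≡p , Qω≡q = surjective p q
                           in ω , trans (sym (P≗P′ ω)) Pω≡p , trans (sym (Q≗Q′ ω)) Qω≡q
    }
    where open OrthogonalPartitions orth

  orthogonal⇒bijective : OrthogonalPartitions P Q → Bijective _≡_ _≡_ (λ ω → P ω , Q ω)
  orthogonal⇒bijective orth =
      (λ eq → injective (cong proj₁ eq) (cong proj₂ eq))
    , strictlySurjective⇒surjective λ (p , q) → let ω , Pω≡p , Qω≡q = surjective p q in ω , cong₂ _,_ Pω≡p Qω≡q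
    where open OrthogonalPartitions orth

module _ {n} {Q : Cell n → Fin n} where

  rowOrthogonal⇒bijective : OrthogonalPartitions proj₁ Q → ∀ i → Bijective _≡_ _≡_ (λ j → Q (i , j))
  rowOrthogonal⇒bijective orth i =
      (λ eq → cong proj₂ (injective refl eq))
    , strictlySurjective⇒surjective onto
    where
    open OrthogonalPartitions orth
    onto : ∀ y → ∃[ j ] Q (i , j) ≡ y
    onto y with (_ , j) , refl , Qω≡y ← surjective i y = j , Qω≡y

  columnOrthogonal⇒bijective : OrthogonalPartitions proj₂ Q → ∀ j → Bijective _≡_ _≡_ (λ i → Q (i , j))
  columnOrthogonal⇒bijective orth j =
      (λ eq → cong proj₁ (injective refl eq))
    , strictlySurjective⇒surjective onto
    where
    open OrthogonalPartitions orth
    onto : ∀ y → ∃[ i ] Q (i , j) ≡ y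
    onto y with (i , _) , refl , Qω≡y ← surjective j y = i , Qω≡y

pairwiseOrthogonal⇒isMOLS : ∀ {n r} {L : Fin r → LatinSquare n} →
  (∀ a b → a ≢ b → OrthogonalPartitions (partitionOf L a) (partitionOf L b)) → IsMOLS L
pairwiseOrthogonal⇒isMOLS orth =
    (λ k → rowOrthogonal⇒bijective (orth zero (suc (suc k)) λ ())
         , columnOrthogonal⇒bijective (orth (suc zero) (suc (suc k)) λ ()))
  , λ k l k≢l → orthogonal⇒bijective (orth (suc (suc k)) (suc (suc l)) (k≢l ∘ suc-injective ∘ suc-injective))

record CayleyIsotopy (A : FiniteGroup) (P Q R : Cell (FiniteGroup.order A) → Fin (FiniteGroup.order A)) : Set where
  open FiniteGroup A
  field
    orthogonal  : OrthogonalPartitions P Q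
    f g         : Fin order → Fin order
    f-injective : Injective _≡_ _≡_ f
    g-injective : Injective _≡_ _≡_ g
    letters     : ∀ ω → R ω ≡ f (P ω) ∙ g (Q ω)

CayleyIsotopy-resp-≗ : ∀ {A P Q R P′ Q′ R′} → P ≗ P′ → Q ≗ Q′ → R ≗ R′ →
                       CayleyIsotopy A P Q R → CayleyIsotopy A P′ Q′ R′
CayleyIsotopy-resp-≗ {A} P≗P′ Q≗Q′ R≗R′ iso = record
  { orthogonal  = OrthogonalPartitions-resp-≗ P≗P′ Q≗Q′ orthogonal
  ; f-injective = f-injective
  ; g-injective = g-injective
  ; letters     = λ ω → trans (sym (R≗R′ ω)) (trans (letters ω) (cong₂ (λ p q → f p ∙ g q) (P≗P′ ω) (Q≗Q′ ω)))
  }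
  where
  open FiniteGroup A
  open CayleyIsotopy iso

module Lines (A : FiniteGroup) (comm : Commutative _≡_ (FiniteGroup._∙_ A))
             {r : ℕ} (σ : Fin r → Fin (FiniteGroup.order A) → Fin (FiniteGroup.order A))
             (σ-homo : ∀ k → IsEndomorphism A (σ k))
             (σ-injective : ∀ k → Injective _≡_ _≡_ (σ k))
             (σ-fixedPointFree : ∀ {k l} → k ≢ l → ∀ y → σ k y ≡ σ l y → y ≡ FiniteGroup.ε A)
             where

  open FiniteGroup A renaming (order to n)

  abelianGroup : AbelianGroup 0ℓ 0ℓ
  abelianGroup = record { isAbelianGroup = record { isGroup = isGroup ; comm = comm } }

  open IsGroup isGroup using (assoc; identityˡ; identityʳ; inverseʳ; _//_)
  open AbelianGroup abelianGroup using (commutativeSemigroup)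
  open import Algebra.Properties.AbelianGroup abelianGroup
  open import Algebra.Properties.CommutativeSemigroup commutativeSemigroup using (interchange)
  open GroupProperties A using (homo⇒ε-homo; homo⇒//-homo; trivialKernel⇒injective)
  open ≡-Reasoning

  ∙-//-cancel : ∀ x y → x ∙ (y // x) ≡ y
  ∙-//-cancel x y = trans (comm x (y // x)) (//-rightDividesˡ x y)

  //-interchange : ∀ a b c d → (a ∙ b) // (c ∙ d) ≡ (a // c) ∙ (b // d)
  //-interchange a b c d = trans (cong (a ∙ b ∙_) (sym (⁻¹-∙-comm c d))) (interchange a b (c ⁻¹) (d ⁻¹))

  //-telescope : ∀ a b c → (b // c) ∙ (a // b) ≡ a // c
  //-telescope a b c = begin
    (b // c) ∙ (a // b)      ≡⟨ comm (b // c) (a // b) ⟩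
    a ∙ b ⁻¹ ∙ (b ∙ c ⁻¹)    ≡⟨ assoc a (b ⁻¹) (b ∙ c ⁻¹) ⟩
    a ∙ (b ⁻¹ ∙ (b ∙ c ⁻¹))  ≡⟨ cong (a ∙_) (\\-leftDividesʳ b (c ⁻¹)) ⟩
    a // c                   ∎

  τ : Fin (suc r) → Fin n → Fin n
  τ zero    _ = ε
  τ (suc k) = σ k

  τ-homo : ∀ s → IsEndomorphism A (τ s)
  τ-homo zero    x y = sym (identityʳ ε)
  τ-homo (suc k)     = σ-homo k

  σ-trivialKernel : ∀ k y → σ k y ≡ ε → y ≡ ε
  σ-trivialKernel k y σy≡ε = σ-injective k (trans σy≡ε (sym (homo⇒ε-homo (σ-homo k))))

  τ-separating : ∀ {s t} → s ≢ t → ∀ y → τ s y ≡ τ t y → y ≡ ε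
  τ-separating {zero}  {zero}  s≢t     = contradiction refl s≢t
  τ-separating {zero}  {suc l} _   y e = σ-trivialKernel l y (sym e)
  τ-separating {suc k} {zero}  _       = σ-trivialKernel k
  τ-separating {suc k} {suc l} k≢l     = σ-fixedPointFree (k≢l ∘ cong suc)

  Δ : Fin (suc r) → Fin (suc r) → Fin n → Fin n
  Δ s t y = τ s y // τ t y

  Δ-homo : ∀ s t → IsEndomorphism A (Δ s t)
  Δ-homo s t x y = trans (cong₂ _//_ (τ-homo s x y) (τ-homo t x y)) (//-interchange _ _ _ _)

  Δ-injective : ∀ {s t} → s ≢ t → Injective _≡_ _≡_ (Δ s t)
  Δ-injective {s} {t} s≢t = trivialKernel⇒injective (Δ-homo s t)
    λ y Δy≡ε → τ-separating s≢t y (x∙y⁻¹≈ε⇒x≈y (τ s y) (τ t y) Δy≡ε)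

  Δ-sym : ∀ s t y → Δ t s y ≡ Δ s t y ⁻¹
  Δ-sym s t y = sym (⁻¹-anti-homo-// (τ s y) (τ t y))

  line : Fin (suc r) → Cell n → Fin n
  line s (i , j) = i ∙ τ s j

  line-// : ∀ s t ω → line s ω // line t ω ≡ Δ s t (proj₂ ω)
  line-// s t (i , j) = begin
    (i ∙ τ s j) // (i ∙ τ t j)  ≡⟨ //-interchange i (τ s j) i (τ t j) ⟩
    (i // i) ∙ Δ s t j          ≡⟨ cong (_∙ Δ s t j) (inverseʳ i) ⟩
    ε ∙ Δ s t j                 ≡⟨ identityˡ (Δ s t j) ⟩
    Δ s t j                     ∎

  line-shift : ∀ s u ω → line u ω ≡ line s ω ∙ Δ u s (proj₂ ω)
  line-shift s u (i , j) = begin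
    i ∙ τ u j                    ≡⟨ cong (i ∙_) (∙-//-cancel (τ s j) (τ u j)) ⟨
    i ∙ (τ s j ∙ Δ u s j)        ≡⟨ assoc i (τ s j) (Δ u s j) ⟨
    i ∙ τ s j ∙ Δ u s j          ∎

  line-column-orthogonal : ∀ s → OrthogonalPartitions (line s) proj₂
  line-column-orthogonal s = record
    { injective  = λ { {i , j} {i′ , _} e refl → cong (_, j) (∙-cancelʳ (τ s j) i i′ e) }
    ; surjective = λ p q → (p // τ s q , q) , //-rightDividesˡ (τ s q) p , refl
    }

  module TwoLines {s t : Fin (suc r)} (s≢t : s ≢ t) where

    Δ⁻¹ : Fin n → Fin n
    Δ⁻¹ p = proj₁ (injective⇒strictlySurjective (Δ-injective s≢t) p)

    Δ-Δ⁻¹ : ∀ p → Δ s t (Δ⁻¹ p) ≡ p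
    Δ-Δ⁻¹ p = proj₂ (injective⇒strictlySurjective (Δ-injective s≢t) p)

    Δ⁻¹-injective : Injective _≡_ _≡_ Δ⁻¹
    Δ⁻¹-injective {p} {q} eq = trans (sym (Δ-Δ⁻¹ p)) (trans (cong (Δ s t) eq) (Δ-Δ⁻¹ q))

    Δ⁻¹-// : ∀ ω → Δ⁻¹ (line s ω) // Δ⁻¹ (line t ω) ≡ proj₂ ω
    Δ⁻¹-// ω = Δ-injective s≢t (begin
      Δ s t (Δ⁻¹ (line s ω) // Δ⁻¹ (line t ω))          ≡⟨ homo⇒//-homo (Δ-homo s t) _ _ ⟩
      Δ s t (Δ⁻¹ (line s ω)) // Δ s t (Δ⁻¹ (line t ω))  ≡⟨ cong₂ _//_ (Δ-Δ⁻¹ _) (Δ-Δ⁻¹ _) ⟩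
      line s ω // line t ω                              ≡⟨ line-// s t ω ⟩
      Δ s t (proj₂ ω)                                   ∎)

    column-determined : ∀ {ω ω′} → line s ω ≡ line s ω′ → line t ω ≡ line t ω′ → proj₂ ω ≡ proj₂ ω′
    column-determined {ω} {ω′} e₁ e₂ = begin
      proj₂ ω                                ≡⟨ Δ⁻¹-// ω ⟨
      Δ⁻¹ (line s ω) // Δ⁻¹ (line t ω)       ≡⟨ cong₂ (λ p q → Δ⁻¹ p // Δ⁻¹ q) e₁ e₂ ⟩
      Δ⁻¹ (line s ω′) // Δ⁻¹ (line t ω′)     ≡⟨ Δ⁻¹-// ω′ ⟩
      proj₂ ω′                               ∎

    lines-orthogonal : OrthogonalPartitions (line s) (line t)
    lines-orthogonal = record { injective = injective ; surjective = surjective }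
      where
      injective : ∀ {ω ω′} → line s ω ≡ line s ω′ → line t ω ≡ line t ω′ → ω ≡ ω′
      injective {i , j} {i′ , j′} e₁ e₂ = cong₂ _,_ (∙-cancelʳ (τ s j) i i′ (trans e₁ (cong (λ y → i′ ∙ τ s y) (sym j≡j′)))) j≡j′
        where
        j≡j′ : j ≡ j′
        j≡j′ = column-determined e₁ e₂

      surjective : ∀ p q → ∃[ ω ] line s ω ≡ p × line t ω ≡ q
      surjective p q = (p // τ s j , j) , //-rightDividesˡ (τ s j) p , (begin
        (p // τ s j) ∙ τ t j           ≡⟨ line-shift s t (p // τ s j , j) ⟩
        (p // τ s j) ∙ τ s j ∙ Δ t s j ≡⟨ cong₂ _∙_ (//-rightDividesˡ (τ s j) p) (Δ-sym s t j) ⟩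
        p ∙ Δ s t j ⁻¹                 ≡⟨ cong (λ x → p ∙ x ⁻¹) (Δ-Δ⁻¹ (p // q)) ⟩
        p ∙ (p // q) ⁻¹                ≡⟨ cong (p ∙_) (⁻¹-anti-homo-// p q) ⟩
        p ∙ (q // p)                   ≡⟨ ∙-//-cancel p q ⟩
        q                              ∎)
        where
        j : Fin n
        j = Δ⁻¹ (p // q)

    lines-column-isotopy : CayleyIsotopy A (line s) (line t) proj₂
    lines-column-isotopy = record
      { orthogonal  = lines-orthogonal
      ; f-injective = Δ⁻¹-injective
      ; g-injective = Δ⁻¹-injective ∘ ⁻¹-injective
      ; letters     = λ ω → sym (Δ⁻¹-// ω)
      }

    three-lines-isotopy : ∀ {u} → u ≢ s → u ≢ t → CayleyIsotopy A (line s) (line t) (line u)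
    three-lines-isotopy {u} u≢s u≢t = record
      { orthogonal  = lines-orthogonal
      ; f-injective = Δ⁻¹-injective ∘ Δ-injective u≢t
      ; g-injective = Δ⁻¹-injective ∘ Δ-injective u≢s ∘ ⁻¹-injective
      ; letters     = letters
      }
      where
      letters : ∀ ω → line u ω ≡ Δ u t (Δ⁻¹ (line s ω)) // Δ u s (Δ⁻¹ (line t ω))
      letters ω = begin
        line u ω                           ≡⟨ line-shift s u ω ⟩
        p ∙ Δ u s (proj₂ ω)                ≡⟨ cong (λ y → p ∙ Δ u s y) (Δ⁻¹-// ω) ⟨
        p ∙ Δ u s (w // v)                 ≡⟨ cong (p ∙_) (homo⇒//-homo (Δ-homo u s) w v) ⟩
        p ∙ (Δ u s w // Δ u s v)           ≡⟨ assoc p (Δ u s w) (Δ u s v ⁻¹) ⟨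
        p ∙ Δ u s w // Δ u s v             ≡⟨ cong (λ x → x ∙ Δ u s w // Δ u s v) (Δ-Δ⁻¹ p) ⟨
        Δ s t w ∙ Δ u s w // Δ u s v       ≡⟨ cong (_// Δ u s v) (//-telescope (τ u w) (τ s w) (τ t w)) ⟩
        Δ u t w // Δ u s v                 ∎
        where
        p w v : Fin n
        p = line s ω
        w = Δ⁻¹ p
        v = Δ⁻¹ (line t ω)

  line-column-isotopy : ∀ {s u} → u ≢ s → CayleyIsotopy A (line s) proj₂ (line u)
  line-column-isotopy {s} {u} u≢s = record
    { orthogonal  = line-column-orthogonal s
    ; f-injective = λ eq → eq
    ; g-injective = Δ-injective u≢s
    ; letters     = line-shift s u
    }

  column-line-isotopy : ∀ {t u} → u ≢ t → CayleyIsotopy A proj₂ (line t) (line u)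
  column-line-isotopy {t} {u} u≢t = record
    { orthogonal  = OrthogonalPartitions-sym (line-column-orthogonal t)
    ; f-injective = Δ-injective u≢t
    ; g-injective = λ eq → eq
    ; letters     = λ ω → trans (line-shift t u ω) (comm (line t ω) _)
    }

  squares : Fin r → LatinSquare n
  squares k i j = i ∙ σ k j

  lineIndex : Fin (suc r) → Fin (2 + r)
  lineIndex zero    = zero
  lineIndex (suc k) = suc (suc k)

  line≗partitionOf : ∀ s → line s ≗ partitionOf squares (lineIndex s)
  line≗partitionOf zero    (i , _) = identityʳ i
  line≗partitionOf (suc k) _       = refl

  data PartitionView : Fin (2 + r) → Set where
    columns : PartitionView (suc zero)
    lines   : ∀ s → PartitionView (lineIndex s)

  partitionView : ∀ a → PartitionView a
  partitionView zero          = lines zero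
  partitionView (suc zero)    = columns
  partitionView (suc (suc k)) = lines (suc k)

  squares-orthogonal : ∀ a b → a ≢ b → OrthogonalPartitions (partitionOf squares a) (partitionOf squares b)
  squares-orthogonal a b a≢b with partitionView a | partitionView b
  ... | columns | columns = contradiction refl a≢b
  ... | lines s | lines t = OrthogonalPartitions-resp-≗ (line≗partitionOf s) (line≗partitionOf t)
                              (TwoLines.lines-orthogonal (a≢b ∘ cong lineIndex))
  ... | lines s | columns = OrthogonalPartitions-resp-≗ (line≗partitionOf s) (λ _ → refl)
                              (line-column-orthogonal s)
  ... | columns | lines t = OrthogonalPartitions-resp-≗ (λ _ → refl) (line≗partitionOf t)
                              (OrthogonalPartitions-sym (line-column-orthogonal t))

  squares-isMOLS : IsMOLS squares
  squares-isMOLS = pairwiseOrthogonal⇒isMOLS squares-orthogonal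

  squares-isotopy : ∀ a b c → a ≢ b → b ≢ c → a ≢ c →
    CayleyIsotopy A (partitionOf squares a) (partitionOf squares b) (partitionOf squares c)
  squares-isotopy a b c a≢b b≢c a≢c with partitionView a | partitionView b | partitionView c
  ... | columns | columns | _       = contradiction refl a≢b
  ... | _       | columns | columns = contradiction refl b≢c
  ... | columns | _       | columns = contradiction refl a≢c
  ... | lines s | lines t | lines u =
    CayleyIsotopy-resp-≗ (line≗partitionOf s) (line≗partitionOf t) (line≗partitionOf u)
      (TwoLines.three-lines-isotopy (a≢b ∘ cong lineIndex) (a≢c ∘ sym ∘ cong lineIndex) (b≢c ∘ sym ∘ cong lineIndex))
  ... | lines s | lines t | columns =
    CayleyIsotopy-resp-≗ (line≗partitionOf s) (line≗partitionOf t) (λ _ → refl)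
      (TwoLines.lines-column-isotopy (a≢b ∘ cong lineIndex))
  ... | lines s | columns | lines u =
    CayleyIsotopy-resp-≗ (line≗partitionOf s) (λ _ → refl) (line≗partitionOf u)
      (line-column-isotopy (a≢c ∘ sym ∘ cong lineIndex))
  ... | columns | lines t | lines u =
    CayleyIsotopy-resp-≗ (λ _ → refl) (line≗partitionOf t) (line≗partitionOf u)
      (column-line-isotopy (b≢c ∘ sym ∘ cong lineIndex))

module Subgroup (G : FiniteGroup) {N : Subset (FiniteGroup.order G)} (N-subgroup : IsSubgroup G N) where

  open FiniteGroup G
  open GroupProperties G using (group)
  open Group group using (rawGroup)

  private
    ε∈N : ε ∈ N
    ε∈N = proj₁ N-subgroup

    ∙-∈N : ∀ x y → x ∈ N → y ∈ N → x ∙ y ∈ N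
    ∙-∈N = proj₁ (proj₂ N-subgroup)

    ⁻¹-∈N : ∀ x → x ∈ N → x ⁻¹ ∈ N
    ⁻¹-∈N = proj₂ (proj₂ N-subgroup)

  ι : Fin ∣ N ∣ → Fin order
  ι = enum N

  infixl 7 _∙ᴺ_
  _∙ᴺ_ : Fin ∣ N ∣ → Fin ∣ N ∣ → Fin ∣ N ∣
  i ∙ᴺ j = index N (∙-∈N (ι i) (ι j) (enum-∈ N i) (enum-∈ N j))

  εᴺ : Fin ∣ N ∣
  εᴺ = index N ε∈N

  _⁻¹ᴺ : Fin ∣ N ∣ → Fin ∣ N ∣
  i ⁻¹ᴺ = index N (⁻¹-∈N (ι i) (enum-∈ N i))

  ι-isGroupMonomorphism : IsGroupMonomorphism (record { _≈_ = _≡_ ; _∙_ = _∙ᴺ_ ; ε = εᴺ ; _⁻¹ = _⁻¹ᴺ }) rawGroup ι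
  ι-isGroupMonomorphism = record
    { isGroupHomomorphism = record
      { isMonoidHomomorphism = record
        { isMagmaHomomorphism = record
          { isRelHomomorphism = record { cong = cong ι }
          ; homo              = λ _ _ → enum-index N _
          }
        ; ε-homo = enum-index N _
        }
      ; ⁻¹-homo = λ _ → enum-index N _
      }
    ; injective = enum-injective N
    }

  open IsGroupMonomorphism ι-isGroupMonomorphism public
    using () renaming (injective to ι-injective; ∙-homo to ι-∙-homo; ε-homo to ι-ε-homo)

  subgroup : FiniteGroup
  subgroup = record
    { order   = ∣ N ∣
    ; _∙_     = _∙ᴺ_
    ; ε       = εᴺ
    ; _⁻¹     = _⁻¹ᴺ
    ; isGroup = GroupMonomorphism.isGroup ι-isGroupMonomorphism isGroup
    }

  subgroup-comm : IsAbelianSubset G N → ∀ i j → i ∙ᴺ j ≡ j ∙ᴺ i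
  subgroup-comm abelian i j = ι-injective (begin
    ι (i ∙ᴺ j)  ≡⟨ ι-∙-homo i j ⟩
    ι i ∙ ι j   ≡⟨ abelian (ι i) (ι j) (enum-∈ N i) (enum-∈ N j) ⟩
    ι j ∙ ι i   ≡⟨ ι-∙-homo j i ⟨
    ι (j ∙ᴺ i)  ∎)
    where open ≡-Reasoning

  restrict-homo : ∀ {f} (f-∈ : ∀ {x} → x ∈ N → f x ∈ N) → IsEndomorphism G f →
                  IsEndomorphism subgroup (restrict N f-∈)
  restrict-homo {f} f-∈ f-homo i j = ι-injective (begin
    ι (restrict N f-∈ (i ∙ᴺ j))                      ≡⟨ enum-restrict N f-∈ (i ∙ᴺ j) ⟩
    f (ι (i ∙ᴺ j))                                   ≡⟨ cong f (ι-∙-homo i j) ⟩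
    f (ι i ∙ ι j)                                    ≡⟨ f-homo (ι i) (ι j) ⟩
    f (ι i) ∙ f (ι j)                                ≡⟨ cong₂ _∙_ (enum-restrict N f-∈ i) (enum-restrict N f-∈ j) ⟨
    ι (restrict N f-∈ i) ∙ ι (restrict N f-∈ j)      ≡⟨ ι-∙-homo _ _ ⟨
    ι (restrict N f-∈ i ∙ᴺ restrict N f-∈ j)         ∎)
    where open ≡-Reasoning

  cayleyIsotopy⇒isotopicToCayley : ∀ {P Q R} → CayleyIsotopy subgroup P Q R → IsotopicToCayley G N P Q R
  cayleyIsotopy⇒isotopicToCayley {P} {Q} {R} iso =
      φ
    , (λ {ω} {ω′} φω≡φω′ → orthogonal.injective (row-injective (cong proj₁ φω≡φω′)) (column-injective (cong proj₂ φω≡φω′)))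
    , (λ ω → enum-∈ N _ , enum-∈ N _)
    , onto
    , (λ ω ω′ → cong (ι ∘ f) , row-injective)
    , (λ ω ω′ → cong (ι ∘ g) , column-injective)
    , (λ ω ω′ → (λ Rω≡Rω′ → trans (product ω) (trans (cong ι Rω≡Rω′) (sym (product ω′))))
              , (λ eq → ι-injective (trans (sym (product ω)) (trans eq (product ω′)))))
    where
    open CayleyIsotopy iso
    module orthogonal = OrthogonalPartitions orthogonal

    φ : Cell ∣ N ∣ → Fin order × Fin order
    φ ω = ι (f (P ω)) , ι (g (Q ω))

    row-injective : ∀ {p p′} → ι (f p) ≡ ι (f p′) → p ≡ p′
    row-injective = f-injective ∘ ι-injective

    column-injective : ∀ {q q′} → ι (g q) ≡ ι (g q′) → q ≡ q′
    column-injective = g-injective ∘ ι-injective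

    product : ∀ ω → ι (f (P ω)) ∙ ι (g (Q ω)) ≡ ι (R ω)
    product ω = trans (sym (ι-∙-homo _ _)) (cong ι (sym (letters ω)))

    onto : ∀ x y → x ∈ N → y ∈ N → ∃[ ω ] φ ω ≡ (x , y)
    onto x y x∈N y∈N =
      let p , fp≡x      = injective⇒strictlySurjective f-injective (index N x∈N)
          q , gq≡y      = injective⇒strictlySurjective g-injective (index N y∈N)
          ω , Pω≡p , Qω≡q = orthogonal.surjective p q
      in ω , cong₂ _,_ (trans (cong (ι ∘ f) Pω≡p) (trans (cong ι fp≡x) (enum-index N x∈N)))
                       (trans (cong (ι ∘ g) Qω≡q) (trans (cong ι gq≡y) (enum-index N y∈N)))

module Frobenius (G : FiniteGroup) (H N : Subset (FiniteGroup.order G))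
                 (complement : IsFrobeniusComplement G H) (kernel : IsFrobeniusKernel G H N) where

  open FiniteGroup G
  open GroupProperties G
  open import Algebra.Properties.Group group
    using (ε⁻¹≈ε; ⁻¹-involutive; \\-leftDividesˡ; \\-leftDividesʳ)
  open IsGroup isGroup using (assoc; identityˡ; identityʳ; inverseˡ)

  private
    ∙-∈H : ∀ x y → x ∈ H → y ∈ H → x ∙ y ∈ H
    ∙-∈H = proj₁ (proj₂ (proj₁ complement))

    ⁻¹-∈H : ∀ x → x ∈ H → x ⁻¹ ∈ H
    ⁻¹-∈H = proj₂ (proj₂ (proj₁ complement))

    frobenius : ∀ g → g ∉ H → ∀ x → x ∈ H → g ⁻¹ ∙ x ∙ g ∈ H → x ≡ ε
    frobenius = proj₂ (proj₂ (proj₂ complement))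

  ∈N-intro : ∀ {x} → x ≡ ε ⊎ (∀ g → conj g x ∉ H) → x ∈ N
  ∈N-intro = proj₂ (kernel _)

  ∈N-elim : ∀ {x} → x ∈ N → x ≡ ε ⊎ (∀ g → conj g x ∉ H)
  ∈N-elim = proj₁ (kernel _)

  ε∈N : ε ∈ N
  ε∈N = ∈N-intro (inj₁ refl)

  ∈N⇒∉H : ∀ {x} → x ∈ N → x ≢ ε → x ∉ H
  ∈N⇒∉H x∈N x≢ε x∈H with ∈N-elim x∈N
  ... | inj₁ x≡ε  = x≢ε x≡ε
  ... | inj₂ never = never ε (subst (_∈ H) (sym (conj-identity _)) x∈H)

  conj-∈N : ∀ g {x} → x ∈ N → conj g x ∈ N
  conj-∈N g x∈N with ∈N-elim x∈N
  ... | inj₁ refl  = ∈N-intro (inj₁ (conj-ε g))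
  ... | inj₂ never = ∈N-intro (inj₂ λ g′ g′gxg⁻¹g′⁻¹∈H → never (g′ ∙ g) (subst (_∈ H) (conj-∘ g′ g _) g′gxg⁻¹g′⁻¹∈H))

  ⁻¹-∈N : ∀ {x} → x ∈ N → x ⁻¹ ∈ N
  ⁻¹-∈N {x} x∈N with ∈N-elim x∈N
  ... | inj₁ refl  = ∈N-intro (inj₁ ε⁻¹≈ε)
  ... | inj₂ never = ∈N-intro (inj₂ λ g gx⁻¹g⁻¹∈H → never g (subst (_∈ H) (conj⁻¹ g) (⁻¹-∈H _ gx⁻¹g⁻¹∈H)))
    where
    conj⁻¹ : ∀ g → conj g (x ⁻¹) ⁻¹ ≡ conj g x
    conj⁻¹ g = trans (cong _⁻¹ (homo⇒⁻¹-homo (conj-homo g) x)) (⁻¹-involutive (conj g x))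

  commuting⇒trivial : ∀ {h m} → h ∈ H → m ∈ N → h ∙ m ≡ m ∙ h → h ≡ ε ⊎ m ≡ ε
  commuting⇒trivial {h} {m} h∈H m∈N hm≡mh with m ≟ ε
  ... | yes m≡ε = inj₂ m≡ε
  ... | no  m≢ε = inj₁ (frobenius m (∈N⇒∉H m∈N m≢ε) h h∈H (subst (_∈ H) (sym m⁻¹hm≡h) h∈H))
    where
    m⁻¹hm≡h : m ⁻¹ ∙ h ∙ m ≡ h
    m⁻¹hm≡h = trans (assoc (m ⁻¹) h m) (trans (cong (m ⁻¹ ∙_) hm≡mh) (\\-leftDividesʳ m h))

  conj-fixedPointFree : ∀ {h h′ y} → h ∈ H → h′ ∈ H → y ∈ N → conj h y ≡ conj h′ y → h ≡ h′ ⊎ y ≡ ε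
  conj-fixedPointFree {h} {h′} {y} h∈H h′∈H y∈N conj≡conj
    with commuting⇒trivial (∙-∈H (h′ ⁻¹) h (⁻¹-∈H h′ h′∈H) h∈H) y∈N c-commutes
    where
    c : Fin order
    c = h′ ⁻¹ ∙ h
    c-fixes : conj c y ≡ y
    c-fixes = begin
      conj (h′ ⁻¹ ∙ h) y         ≡⟨ conj-∘ (h′ ⁻¹) h y ⟨
      conj (h′ ⁻¹) (conj h y)    ≡⟨ cong (conj (h′ ⁻¹)) conj≡conj ⟩
      conj (h′ ⁻¹) (conj h′ y)   ≡⟨ conj-∘ (h′ ⁻¹) h′ y ⟩
      conj (h′ ⁻¹ ∙ h′) y        ≡⟨ cong (λ g → conj g y) (inverseˡ h′) ⟩
      conj ε y                   ≡⟨ conj-identity y ⟩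
      y                          ∎
      where open ≡-Reasoning
    c-commutes : c ∙ y ≡ y ∙ c
    c-commutes = trans (sym (conj-∙ c y)) (cong (_∙ c) c-fixes)
  ... | inj₂ y≡ε = inj₂ y≡ε
  ... | inj₁ c≡ε = inj₁ (trans (sym (\\-leftDividesˡ h′ h)) (trans (cong (h′ ∙_) c≡ε) (identityʳ h′)))

  module AbelianKernel (abelian : IsAbelianSubset G N) where

    -- x ∙ y would be a nontrivial element of H commuting with x ∈ N
    product∉H : ∀ {x y} → x ∈ N → y ∈ N → x ∙ y ≢ ε → x ∙ y ∉ H
    product∉H {x} {y} x∈N y∈N xy≢ε xy∈H with commuting⇒trivial xy∈H x∈N xy-commutes
      where
      xy-commutes : x ∙ y ∙ x ≡ x ∙ (x ∙ y)
      xy-commutes = trans (assoc x y x) (cong (x ∙_) (abelian y x y∈N x∈N))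
    ... | inj₁ xy≡ε = xy≢ε xy≡ε
    ... | inj₂ refl = ∈N⇒∉H y∈N (xy≢ε ∘ trans (identityˡ y)) (subst (_∈ H) (identityˡ y) xy∈H)

    ∙-∈N : ∀ x y → x ∈ N → y ∈ N → x ∙ y ∈ N
    ∙-∈N x y x∈N y∈N with x ∙ y ≟ ε
    ... | yes xy≡ε = ∈N-intro (inj₁ xy≡ε)
    ... | no  xy≢ε = ∈N-intro (inj₂ λ g gxyg⁻¹∈H →
      product∉H (conj-∈N g x∈N) (conj-∈N g y∈N)
        (xy≢ε ∘ conj-trivialKernel g ∘ trans (conj-homo g x y))
        (subst (_∈ H) (conj-homo g x y) gxyg⁻¹∈H))

    isSubgroup : IsSubgroup G N
    isSubgroup = ε∈N , ∙-∈N , λ _ → ⁻¹-∈N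

    open Subgroup G isSubgroup public using (subgroup; subgroup-comm; cayleyIsotopy⇒isotopicToCayley)
    open Subgroup G isSubgroup using (εᴺ; ι-injective; ι-ε-homo; restrict-homo)

    conjugation : Fin ∣ H ∣ → Fin ∣ N ∣ → Fin ∣ N ∣
    conjugation k = restrict N (conj-∈N (enum H k))

    conjugation-homo : ∀ k → IsEndomorphism subgroup (conjugation k)
    conjugation-homo k = restrict-homo (conj-∈N (enum H k)) (conj-homo (enum H k))

    conjugation-injective : ∀ k → Injective _≡_ _≡_ (conjugation k)
    conjugation-injective k = restrict-injective N (conj-∈N (enum H k)) (conj-injective (enum H k))

    conjugation-fixedPointFree : ∀ {k l} → k ≢ l → ∀ i → conjugation k i ≡ conjugation l i → i ≡ εᴺ
    conjugation-fixedPointFree {k} {l} k≢l i eq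
      with conj-fixedPointFree (enum-∈ H k) (enum-∈ H l) (enum-∈ N i) (begin
        conj (enum H k) (enum N i)   ≡⟨ enum-restrict N (conj-∈N (enum H k)) i ⟨
        enum N (conjugation k i)     ≡⟨ cong (enum N) eq ⟩
        enum N (conjugation l i)     ≡⟨ enum-restrict N (conj-∈N (enum H l)) i ⟩
        conj (enum H l) (enum N i)   ∎)
      where open ≡-Reasoning
    ... | inj₁ hₖ≡hₗ = contradiction (enum-injective H hₖ≡hₗ) k≢l
    ... | inj₂ i≡ε   = ι-injective (trans i≡ε (sym ι-ε-homo))

    open Lines subgroup (subgroup-comm abelian) conjugation conjugation-homo conjugation-injective conjugation-fixedPointFree public
      using (squares; squares-isMOLS; squares-isotopy)

theorem3 : (G : FiniteGroup) (H N : Subset (FiniteGroup.order G)) →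
  IsFrobeniusComplement G H →
  IsFrobeniusKernel G H N →
  IsAbelianSubset G N →
  Σ (Fin ∣ H ∣ → LatinSquare ∣ N ∣) λ L →
      IsMOLS L
    × (∀ (a b c : Fin (2 + ∣ H ∣)) → a ≢ b → b ≢ c → a ≢ c →
        IsotopicToCayley G N (partitionOf L a) (partitionOf L b) (partitionOf L c))
theorem3 G H N complement kernel abelian =
  squares , squares-isMOLS , λ a b c a≢b b≢c a≢c → cayleyIsotopy⇒isotopicToCayley (squares-isotopy a b c a≢b b≢c a≢c)
  where open Frobenius.AbelianKernel G H N complement kernel abelian
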